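{- If $G$ and $H$ are graphs, then $$\mathrm{sg}(G \,\square\, H) \leq \min\{ \mathrm{sgc}(H)(n(G)-1) + \mathrm{sg}(H),\ \mathrm{sgc}(G)(n(H)-1) +\mathrm{sg}(G) \}.$$
   Context: Graphs are finite and simple; strong geodetic notions are considered for connected graphs. $G\,\square\,H$ is the Cartesian product: vertex set $V(G)\times V(H)$, with $(g,h)\sim(g',h')$ iff either $g=g'$ and $hh'\in E(H)$, or $h=h'$ and $gg'\in E(G)$. $n(G)$ is the order of $G$. For a graph $G$ and $S\subseteq V(G)$, one fixes for each unordered pair $\{x,y\}$ of distinct vertices of $S$ a single shortest $x,y$-path $\widetilde g(x,y)$; $S$ is a strong geodetic set if for some such choice the union of the vertex sets of the chosen paths equals $V(G)$ (for a one-vertex graph, that vertex forms a strong geodetic set). $\mathrm{sg}(G)$ is the minimum size of a strong geodetic set; a minimum one is an sg-set. For a strong geodetic set $S$, a set $X\subseteq S$ is a strong geodetic core for $S$ if there exists a choice of fixed shortest paths $\widetilde g(x,y)$ for pairs of $S$ such that $\bigcup_{(u,v)\in X\times S} V(\widetilde g(u,v)) = V(G)$. $\mathrm{sgc}(S)$ is the minimum size of a strong geodetic core for $S$, and $\mathrm{sgc}(G)=\min\{\mathrm{sgc}(S): S \text{ an sg-set of } G\}$. -}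

module Defs where

open import Data.Nat using (ℕ; zero; suc; _+_; _*_; _∸_; _≤_; _<_)
open import Data.Fin using (Fin; toℕ; inject₁; remQuot) renaming (suc to fsuc)
open import Data.Fin.Subset using (Subset; _∈_; _⊆_; ∣_∣)
open import Data.Vec using (Vec; head; last; lookup)
open import Data.Product using (Σ; ∃; _×_; _,_; proj₁; proj₂)
open import Data.Sum using (_⊎_; inj₁; inj₂)
open import Data.Empty using (⊥)
open import Data.Unit using (⊤)
open import Relation.Binary.PropositionalEquality using (_≡_)
open import Relation.Nullary using (¬_)
open import Level using (0ℓ) renaming (suc to lsuc)

record Graph : Set₁ where
  field
    order : ℕ
    Adj   : Fin order → Fin order → Set
    sym   : ∀ {x y} → Adj x y → Adj y x
    irrefl : ∀ {x} → ¬ Adj x x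
open Graph public

n : Graph → ℕ
n = order

IsWalk : (G : Graph) {len : ℕ} → Vec (Fin (order G)) (suc len)
       → Fin (order G) → Fin (order G) → Set
IsWalk G {len} ws x y =
  (head ws ≡ x) × (last ws ≡ y) ×
  (∀ (i : Fin len) → Adj G (lookup ws (inject₁ i)) (lookup ws (fsuc i)))

Connected : Graph → Set
Connected G = ∀ (x y : Fin (order G)) →
  Σ ℕ λ len → Σ (Vec (Fin (order G)) (suc len)) λ ws → IsWalk G ws x y

record Geodesic (G : Graph) (x y : Fin (order G)) : Set where
  field
    len   : ℕ
    verts : Vec (Fin (order G)) (suc len)
    walk  : IsWalk G verts x y
    short : ∀ m (ws : Vec (Fin (order G)) (suc m)) → IsWalk G ws x y → len ≤ m
open Geodesic public

_OnGeod_ : {G : Graph} {x y : Fin (order G)} → Fin (order G) → Geodesic G x y → Set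
v OnGeod P = Σ (Fin (suc (len P))) λ i → lookup (verts P) i ≡ v

-- A choice of one fixed shortest path g̃(x,y) for each unordered pair {x,y}
-- of distinct vertices of S (indexed by the pair with toℕ x < toℕ y).
PathChoice : (G : Graph) → Subset (order G) → Set
PathChoice G S = ∀ (x y : Fin (order G)) → x ∈ S → y ∈ S → toℕ x < toℕ y → Geodesic G x y

CoveredBy : (G : Graph) (S : Subset (order G)) → PathChoice G S
          → (Fin (order G) → Fin (order G) → Set) → Fin (order G) → Set
CoveredBy G S P Q v =
  Σ (Fin (order G)) λ x → Σ (Fin (order G)) λ y →
  Σ (x ∈ S) λ xS → Σ (y ∈ S) λ yS → Σ (toℕ x < toℕ y) λ lt →
  Q x y × (v OnGeod P x y xS yS lt)

-- S is a strong geodetic set (one-vertex graph: that vertex suffices).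
StrongGeodetic : (G : Graph) → Subset (order G) → Set
StrongGeodetic G S =
  ((order G ≡ 1) × (∀ v → v ∈ S)) ⊎
  (Σ (PathChoice G S) λ P → ∀ v → CoveredBy G S P (λ _ _ → ⊤) v)

IsSgSet : (G : Graph) → Subset (order G) → Set
IsSgSet G S = StrongGeodetic G S × (∀ T → StrongGeodetic G T → ∣ S ∣ ≤ ∣ T ∣)

HasSg : Graph → ℕ → Set
HasSg G k = Σ (Subset (order G)) λ S → IsSgSet G S × (∣ S ∣ ≡ k)

-- X ⊆ S is a strong geodetic core for S: for some path choice, the union of
-- V(g̃(u,v)) over (u,v) ∈ X × S is V(G). The pair (u,u) contributes {u}.
IsCore : (G : Graph) → Subset (order G) → Subset (order G) → Set
IsCore G S X = (X ⊆ S) ×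
  (Σ (PathChoice G S) λ P → ∀ v →
     (v ∈ X) ⊎ CoveredBy G S P (λ x y → (x ∈ X) ⊎ (y ∈ X)) v)

-- sgc(G) = k : min of sgc(S) over sg-sets S, i.e. min of |X| over
-- sg-sets S and strong geodetic cores X for S.
HasSgc : Graph → ℕ → Set
HasSgc G k =
  (Σ (Subset (order G)) λ S → Σ (Subset (order G)) λ X →
     IsSgSet G S × IsCore G S X × (∣ X ∣ ≡ k)) ×
  (∀ S X → IsSgSet G S → IsCore G S X → k ≤ ∣ X ∣)

-- Cartesian product G □ H on Fin (n G * n H); vertex i ↔ remQuot (n H) i = (g , h).
pr : (G H : Graph) → Fin (order G * order H) → Fin (order G) × Fin (order H)
pr G H i = remQuot {order G} (order H) i

□Adj : (G H : Graph) → Fin (order G * order H) → Fin (order G * order H) → Set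
□Adj G H i j =
  ((proj₁ (pr G H i) ≡ proj₁ (pr G H j)) × Adj H (proj₂ (pr G H i)) (proj₂ (pr G H j))) ⊎
  ((proj₂ (pr G H i) ≡ proj₂ (pr G H j)) × Adj G (proj₁ (pr G H i)) (proj₁ (pr G H j)))

□sym : (G H : Graph) → ∀ {i j} → □Adj G H i j → □Adj G H j i
□sym G H (inj₁ (e , a)) = inj₁ (≡sym e , Graph.sym H a)
  where open import Relation.Binary.PropositionalEquality using () renaming (sym to ≡sym)
□sym G H (inj₂ (e , a)) = inj₂ (≡sym e , Graph.sym G a)
  where open import Relation.Binary.PropositionalEquality using () renaming (sym to ≡sym)

□irrefl : (G H : Graph) → ∀ {i} → ¬ □Adj G H i i
□irrefl G H (inj₁ (_ , a)) = Graph.irrefl H a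
□irrefl G H (inj₂ (_ , a)) = Graph.irrefl G a

_□_ : Graph → Graph → Graph
G □ H = record
  { order = order G * order H
  ; Adj = □Adj G H
  ; sym = □sym G H
  ; irrefl = □irrefl G H
  }

module Submission where

-- Let S be an sg-set of H with a strong geodetic core X of size sgc(H), and
-- let g₀ be the vertex of G with index 0.  The set
--   T = ({g₀} × S) ∪ ((V(G) ∖ {g₀}) × X)
-- has at most |X|(n(G) - 1) + |S| elements and is strong geodetic in G □ H:
-- the chosen geodesic between two vertices of T travels through G-layers
-- and crosses once along a chosen H-geodesic of S, in the layer of its
-- start if it ends in the g₀-layer and in the layer of its end otherwise.
-- A vertex (g , h) with h on the chosen path of {u , w}, u ∈ X, then lies
-- on the geodesic between (g , u) and (g₀ , w) in either direction.
--
-- Applying it to G □ H with either factor as the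
-- H-side gives both bounds; since ≤ on ℕ is decidable the double negation
-- disappears at the very end.

open import Defs hiding (sym)
open import Data.Nat using (ℕ; zero; suc; _+_; _*_; _∸_; _≤_; _<_; _⊓_; z≤n; _≤?_)
open import Data.Nat.Properties
  using (module ≤-Reasoning; +-comm; +-assoc; +-suc; +-identityʳ; *-comm; ≤-refl; ≤-trans; ≤-reflexive; ≤-pred; +-mono-≤; +-monoʳ-≤;
         ≮⇒≥; n≮0; <-cmp; <-irrefl; <-asym; <-irrelevant; ⊓-glb; m*n≡1⇒m≡1; m*n≡1⇒n≡1;
         +-0-commutativeMonoid; +-commutativeSemigroup)
  renaming (_≟_ to _≟ℕ_)
open import Data.Fin using (Fin; toℕ; inject₁; remQuot; combine; _↑ˡ_; _↑ʳ_)
  renaming (zero to fzero; suc to fsuc; _≟_ to _≟ᶠ_)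
open import Data.Fin.Properties using (toℕ-injective; remQuot-combine; combine-remQuot)
open import Data.Fin.Subset using (Subset; Side; inside; outside; _∈_; _⊆_; ∣_∣)
open import Data.Vec using (Vec; _∷_; []; head; last; lookup; tabulate)
open import Data.Vec.Properties using (lookup∘tabulate; []=⇒lookup; lookup⇒[]=)
open import Data.Vec.Properties.WithK using ([]=-irrelevant)
open import Data.Product using (Σ; _×_; _,_; proj₁; proj₂)
open import Data.Sum using (_⊎_; inj₁; inj₂)
open import Data.Empty using (⊥-elim)
open import Data.Unit using (⊤; tt)
open import Relation.Nullary using (¬_; yes; no)
open import Relation.Nullary.Decidable using (decidable-stable)
open import Relation.Nullary.Negation using (¬¬-map)
open import Relation.Binary.Definitions using (tri<; tri≈; tri>)
open import Relation.Binary.PropositionalEquality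
  using (_≡_; _≢_; refl; sym; trans; cong; cong₂; subst; subst₂; module ≡-Reasoning)
open import Algebra.Properties.CommutativeSemigroup +-commutativeSemigroup using (x∙yz≈y∙xz)
open import Algebra.Properties.CommutativeMonoid.Sum +-0-commutativeMonoid
  using (sum; sum-cong-≗; ∑-comm; sum-syntax)

data Walk (G : Graph) : Fin (order G) → Fin (order G) → Set where
  stop : ∀ x → Walk G x x
  step : ∀ {x y z} → Adj G x y → Walk G y z → Walk G x z

module _ {G : Graph} where

  length : ∀ {x y} → Walk G x y → ℕ
  length (stop _)   = 0
  length (step _ w) = suc (length w)

  _∈ʷ_ : ∀ {x y} → Fin (order G) → Walk G x y → Set
  v ∈ʷ stop x         = v ≡ x
  v ∈ʷ step {x} _ w   = (v ≡ x) ⊎ (v ∈ʷ w)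

  start∈ʷ : ∀ {x y} (w : Walk G x y) → x ∈ʷ w
  start∈ʷ (stop _)   = refl
  start∈ʷ (step _ w) = inj₁ refl

  end∈ʷ : ∀ {x y} (w : Walk G x y) → y ∈ʷ w
  end∈ʷ (stop _)   = refl
  end∈ʷ (step _ w) = inj₂ (end∈ʷ w)

  ∈ʷ-resp-≡ : ∀ {x y v v'} (w : Walk G x y) → v ≡ v' → v ∈ʷ w → v' ∈ʷ w
  ∈ʷ-resp-≡ w refl m = m

  _++ʷ_ : ∀ {x y z} → Walk G x y → Walk G y z → Walk G x z
  stop _   ++ʷ w' = w'
  step e w ++ʷ w' = step e (w ++ʷ w')

  length-++ʷ : ∀ {x y z} (w : Walk G x y) (w' : Walk G y z) → length (w ++ʷ w') ≡ length w + length w'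
  length-++ʷ (stop _)   w' = refl
  length-++ʷ (step e w) w' = cong suc (length-++ʷ w w')

  ∈ʷ-++ˡ : ∀ {x y z v} (w : Walk G x y) (w' : Walk G y z) → v ∈ʷ w → v ∈ʷ (w ++ʷ w')
  ∈ʷ-++ˡ (stop _)   w' refl     = start∈ʷ w'
  ∈ʷ-++ˡ (step e w) w' (inj₁ p) = inj₁ p
  ∈ʷ-++ˡ (step e w) w' (inj₂ m) = inj₂ (∈ʷ-++ˡ w w' m)

  ∈ʷ-++ʳ : ∀ {x y z v} (w : Walk G x y) (w' : Walk G y z) → v ∈ʷ w' → v ∈ʷ (w ++ʷ w')
  ∈ʷ-++ʳ (stop _)   w' m = m
  ∈ʷ-++ʳ (step e w) w' m = inj₂ (∈ʷ-++ʳ w w' m)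

  reverse : ∀ {x y} → Walk G x y → Walk G y x
  reverse (stop x)       = stop x
  reverse (step {x} e w) = reverse w ++ʷ step (Graph.sym G e) (stop x)

  length-reverse : ∀ {x y} (w : Walk G x y) → length (reverse w) ≡ length w
  length-reverse (stop x)       = refl
  length-reverse (step {x} e w) = begin
    length (reverse w ++ʷ step (Graph.sym G e) (stop x)) ≡⟨ length-++ʷ (reverse w) _ ⟩
    length (reverse w) + 1                             ≡⟨ cong (_+ 1) (length-reverse w) ⟩
    length w + 1                                       ≡⟨ +-comm (length w) 1 ⟩
    suc (length w)                                     ∎
    where open ≡-Reasoning

  ∈ʷ-reverse : ∀ {x y v} (w : Walk G x y) → v ∈ʷ w → v ∈ʷ reverse w
  ∈ʷ-reverse (stop x)   m        = m
  ∈ʷ-reverse (step e w) (inj₁ p) = ∈ʷ-++ʳ (reverse w) _ (inj₂ p)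
  ∈ʷ-reverse (step e w) (inj₂ m) = ∈ʷ-++ˡ (reverse w) _ (∈ʷ-reverse w m)

  retarget : ∀ {x x' y y'} → x ≡ x' → y ≡ y' → Walk G x y → Walk G x' y'
  retarget refl refl w = w

  length-retarget : ∀ {x x' y y'} (p : x ≡ x') (q : y ≡ y') (w : Walk G x y) →
    length (retarget p q w) ≡ length w
  length-retarget refl refl w = refl

  ∈ʷ-retarget : ∀ {x x' y y' v} (p : x ≡ x') (q : y ≡ y') (w : Walk G x y) →
    v ∈ʷ w → v ∈ʷ retarget p q w
  ∈ʷ-retarget refl refl w m = m

module _ {G K : Graph} (f : Fin (order G) → Fin (order K))
         (hom : ∀ {a b} → Adj G a b → Adj K (f a) (f b)) where

  mapʷ : ∀ {x y} → Walk G x y → Walk K (f x) (f y)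
  mapʷ (stop x)   = stop (f x)
  mapʷ (step e w) = step (hom e) (mapʷ w)

  length-mapʷ : ∀ {x y} (w : Walk G x y) → length (mapʷ w) ≡ length w
  length-mapʷ (stop x)   = refl
  length-mapʷ (step e w) = cong suc (length-mapʷ w)

  ∈ʷ-mapʷ : ∀ {x y v} (w : Walk G x y) → v ∈ʷ w → f v ∈ʷ mapʷ w
  ∈ʷ-mapʷ (stop x)   refl        = refl
  ∈ʷ-mapʷ (step e w) (inj₁ refl) = inj₁ refl
  ∈ʷ-mapʷ (step e w) (inj₂ m)    = inj₂ (∈ʷ-mapʷ w m)

record Shortest (G : Graph) (x y : Fin (order G)) : Set where
  constructor shortest
  field
    path    : Walk G x y
    minimal : ∀ (w : Walk G x y) → length path ≤ length w
open Shortest public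

module _ {G : Graph} where

  toVec : ∀ {x y} (w : Walk G x y) → Vec (Fin (order G)) (suc (length w))
  toVec (stop x)       = x ∷ []
  toVec (step {x} _ w) = x ∷ toVec w

  toVec-head : ∀ {x y} (w : Walk G x y) → head (toVec w) ≡ x
  toVec-head (stop _)   = refl
  toVec-head (step _ _) = refl

  toVec-last : ∀ {x y} (w : Walk G x y) → last (toVec w) ≡ y
  toVec-last (stop _)            = refl
  toVec-last (step _ (stop _))   = refl
  toVec-last (step _ (step e w)) = toVec-last (step e w)

  toVec-adjacent : ∀ {x y} (w : Walk G x y) (i : Fin (length w)) →
    Adj G (lookup (toVec w) (inject₁ i)) (lookup (toVec w) (fsuc i))
  toVec-adjacent (step e (stop _))   fzero    = e
  toVec-adjacent (step e (step _ _)) fzero    = e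
  toVec-adjacent (step e w)         (fsuc i) = toVec-adjacent w i

  toVec-isWalk : ∀ {x y} (w : Walk G x y) → IsWalk G (toVec w) x y
  toVec-isWalk w = toVec-head w , toVec-last w , toVec-adjacent w

  toVec-∈ʷ : ∀ {x y v} (w : Walk G x y) → v ∈ʷ w → Σ (Fin (suc (length w))) λ i → lookup (toVec w) i ≡ v
  toVec-∈ʷ (stop _)   refl        = fzero , refl
  toVec-∈ʷ (step _ w) (inj₁ refl) = fzero , refl
  toVec-∈ʷ (step _ w) (inj₂ m)    with toVec-∈ʷ w m
  ... | i , eq = fsuc i , eq

  fromVec : ∀ {m} (ws : Vec (Fin (order G)) (suc m)) {x y} → IsWalk G ws x y →
    Σ (Walk G x y) λ w → length w ≡ m
  fromVec {zero}  (v ∷ [])     (refl , refl , _)   = stop v , refl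
  fromVec {suc m} (v ∷ u ∷ us) (refl , ends , adj) with fromVec (u ∷ us) (refl , ends , λ i → adj (fsuc i))
  ... | w , eq = step (adj fzero) w , cong suc eq

  fromVec-∈ʷ : ∀ {m} (ws : Vec (Fin (order G)) (suc m)) {x y} (iw : IsWalk G ws x y) →
    ∀ i {v} → lookup ws i ≡ v → v ∈ʷ proj₁ (fromVec ws iw)
  fromVec-∈ʷ {zero}  (v ∷ [])     (refl , refl , _)   fzero    eq = sym eq
  fromVec-∈ʷ {suc m} (v ∷ u ∷ us) (refl , ends , adj) fzero    eq = inj₁ (sym eq)
  fromVec-∈ʷ {suc m} (v ∷ u ∷ us) (refl , ends , adj) (fsuc i) eq =
    inj₂ (fromVec-∈ʷ (u ∷ us) (refl , ends , λ i → adj (fsuc i)) i eq)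

  -- Shortest walks are exactly the geodesics of Defs, with the same vertices
  -- (the two notions of minimality agree because walks and vector walks correspond).
  toGeodesic : ∀ {x y} → Shortest G x y → Geodesic G x y
  toGeodesic (shortest w min) = record
    { len   = length w
    ; verts = toVec w
    ; walk  = toVec-isWalk w
    ; short = λ m ws iw → subst (length w ≤_) (proj₂ (fromVec ws iw)) (min (proj₁ (fromVec ws iw)))
    }

  toGeodesic-∈ʷ : ∀ {x y v} (s : Shortest G x y) → v ∈ʷ path s → v OnGeod toGeodesic s
  toGeodesic-∈ʷ s = toVec-∈ʷ (path s)

  fromGeodesic : ∀ {x y} → Geodesic G x y → Shortest G x y
  fromGeodesic {x} {y} P = shortest w λ w' →
      subst (_≤ length w') (sym (proj₂ walk-of-P)) (short P (length w') (toVec w') (toVec-isWalk w'))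
    where
    walk-of-P : Σ (Walk G x y) λ w → length w ≡ len P
    walk-of-P = fromVec (verts P) (walk P)
    w : Walk G x y
    w = proj₁ walk-of-P

  fromGeodesic-∈ʷ : ∀ {x y v} (P : Geodesic G x y) → v OnGeod P → v ∈ʷ path (fromGeodesic P)
  fromGeodesic-∈ʷ P (i , eq) = fromVec-∈ʷ (verts P) (walk P) i eq

  reverse-shortest : ∀ {x y} → Shortest G x y → Shortest G y x
  reverse-shortest (shortest w min) = shortest (reverse w) λ w' →
    subst₂ _≤_ (sym (length-reverse w)) (length-reverse w') (min (reverse w'))

  stop-shortest : ∀ x → Shortest G x x
  stop-shortest x = shortest (stop x) λ _ → z≤n

  no-detour-at-end : (σ : ∀ a a' → Shortest G a a') → ∀ a a' c → (c ≡ a) ⊎ (c ≡ a') →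
    length (path (σ a c)) + length (path (σ c a')) ≤ length (path (σ a a'))
  no-detour-at-end σ a a' c (inj₁ refl) = +-mono-≤ (minimal (σ a a) (stop a)) ≤-refl
  no-detour-at-end σ a a' c (inj₂ refl) =
    ≤-trans (+-mono-≤ ≤-refl (minimal (σ a' a') (stop a'))) (≤-reflexive (+-identityʳ _))

least-¬¬ : ∀ {A : Set} (μ : A → ℕ) → A → ¬ ¬ (Σ A λ a → ∀ b → μ a ≤ μ b)
least-¬¬ {A} μ a₀ = below (μ a₀) a₀ ≤-refl
  where
  -- Induction on a bound for μ a: if a is not least, a smaller b exists.
  below : ∀ bound a → μ a ≤ bound → ¬ ¬ (Σ A λ a → ∀ b → μ a ≤ μ b)
  below bound a μa≤bound noLeast = noLeast (a , λ b → ≮⇒≥ (noSmaller bound μa≤bound b))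
    where
    noSmaller : ∀ bound → μ a ≤ bound → ∀ b → ¬ (μ b < μ a)
    noSmaller zero    μa≤0 b lt = n≮0 (≤-trans lt μa≤0)
    noSmaller (suc k) μa≤k+1 b lt = below k b (≤-pred (≤-trans lt μa≤k+1)) noLeast

¬¬-∀-Fin : ∀ {m} {P : Fin m → Set} → (∀ i → ¬ ¬ P i) → ¬ ¬ (∀ i → P i)
¬¬-∀-Fin {zero}  h notAll = notAll λ ()
¬¬-∀-Fin {suc m} h notAll =
  h fzero λ p₀ → ¬¬-∀-Fin (λ i → h (fsuc i)) λ ps → notAll λ { fzero → p₀ ; (fsuc i) → ps i }

shortest-walks-¬¬ : (G : Graph) → Connected G → ¬ ¬ (∀ x y → Shortest G x y)
shortest-walks-¬¬ G connected =
  ¬¬-∀-Fin λ x → ¬¬-∀-Fin λ y → shortest-¬¬ x y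
  where
  shortest-¬¬ : ∀ x y → ¬ ¬ Shortest G x y
  shortest-¬¬ x y noShortest with connected x y
  ... | _ , ws , iw = least-¬¬ length (proj₁ (fromVec ws iw)) λ (w , min) → noShortest (shortest w min)

∑-const : ∀ k c → ∑[ i < k ] c ≡ k * c
∑-const zero    c = refl
∑-const (suc k) c = cong (c +_) (∑-const k c)

∑-↑ : ∀ m {n} (f : Fin (m + n) → ℕ) → sum f ≡ ∑[ i < m ] f (i ↑ˡ n) + ∑[ j < n ] f (m ↑ʳ j)
∑-↑ zero    f = refl
∑-↑ (suc m) f = trans (cong (f fzero +_) (∑-↑ m (λ i → f (fsuc i)))) (sym (+-assoc (f fzero) _ _))

∑-combine : ∀ m n (f : Fin (m * n) → ℕ) → sum f ≡ ∑[ a < m ] ∑[ b < n ] f (combine a b)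
∑-combine zero    n f = refl
∑-combine (suc m) n f =
  trans (∑-↑ n f) (cong (∑[ b < n ] f (combine {suc m} fzero b) +_) (∑-combine m n (λ j → f (n ↑ʳ j))))

indicator : Side → ℕ
indicator inside  = 1
indicator outside = 0

∣∣≡∑ : ∀ {m} (p : Subset m) → ∣ p ∣ ≡ ∑[ i < m ] indicator (lookup p i)
∣∣≡∑ []            = refl
∣∣≡∑ (inside ∷ p)  = cong suc (∣∣≡∑ p)
∣∣≡∑ (outside ∷ p) = ∣∣≡∑ p

∑-first-and-rest : ∀ {m} (F : Fin m → ℕ) {s x} →
  (∀ a → toℕ a ≡ 0 → F a ≡ s) → (∀ a → toℕ a ≢ 0 → F a ≡ x) → sum F ≤ x * (m ∸ 1) + s
∑-first-and-rest {zero}  F first rest = z≤n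
∑-first-and-rest {suc k} F {s} {x} first rest = ≤-reflexive (begin
    F fzero + ∑[ i < k ] F (fsuc i) ≡⟨ cong₂ _+_ (first fzero refl) (sum-cong-≗ λ i → rest (fsuc i) λ ()) ⟩
    s + ∑[ i < k ] x                ≡⟨ cong (s +_) (∑-const k x) ⟩
    s + k * x                       ≡⟨ +-comm s (k * x) ⟩
    k * x + s                       ≡⟨ cong (_+ s) (*-comm k x) ⟩
    x * k + s                       ∎)
  where open ≡-Reasoning

record Coordinates (A B K : Graph) : Set where
  field
    fst        : Fin (order K) → Fin (order A)
    snd        : Fin (order K) → Fin (order B)
    mk         : Fin (order A) → Fin (order B) → Fin (order K)
    fst-mk     : ∀ a b → fst (mk a b) ≡ a
    snd-mk     : ∀ a b → snd (mk a b) ≡ b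
    mk-fst-snd : ∀ v → mk (fst v) (snd v) ≡ v
    adj-split  : ∀ {x y} → Adj K x y →
      (fst x ≡ fst y × Adj B (snd x) (snd y)) ⊎ (snd x ≡ snd y × Adj A (fst x) (fst y))
    adj-join   : ∀ {x y} →
      (fst x ≡ fst y × Adj B (snd x) (snd y)) ⊎ (snd x ≡ snd y × Adj A (fst x) (fst y)) → Adj K x y
    order-K    : order K ≡ order A * order B
    ∑-pairs    : ∀ (f : Fin (order K) → ℕ) → sum f ≡ ∑[ a < order A ] ∑[ b < order B ] f (mk a b)

□-coordinates : (G H : Graph) → Coordinates G H (G □ H)
□-coordinates G H = record
  { fst        = λ v → proj₁ (remQuot {order G} (order H) v)
  ; snd        = λ v → proj₂ (remQuot {order G} (order H) v)
  ; mk         = combine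
  ; fst-mk     = λ a b → cong proj₁ (remQuot-combine a b)
  ; snd-mk     = λ a b → cong proj₂ (remQuot-combine a b)
  ; mk-fst-snd = combine-remQuot {order G} (order H)
  ; adj-split  = λ e → e
  ; adj-join   = λ e → e
  ; order-K    = refl
  ; ∑-pairs    = ∑-combine (order G) (order H)
  }

□-coordinates-swapped : (G H : Graph) → Coordinates H G (G □ H)
□-coordinates-swapped G H = record
  { fst        = λ v → proj₂ (remQuot {order G} (order H) v)
  ; snd        = λ v → proj₁ (remQuot {order G} (order H) v)
  ; mk         = λ h g → combine g h
  ; fst-mk     = λ h g → cong proj₂ (remQuot-combine g h)
  ; snd-mk     = λ h g → cong proj₁ (remQuot-combine g h)
  ; mk-fst-snd = combine-remQuot {order G} (order H)
  ; adj-split  = swap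
  ; adj-join   = swap
  ; order-K    = *-comm (order G) (order H)
  ; ∑-pairs    = λ f → trans (∑-combine (order G) (order H) f) (∑-comm {order G} {order H} (λ g h → f (combine g h)))
  }
  where
  swap : ∀ {P Q R S : Set} → (P × Q) ⊎ (R × S) → (R × S) ⊎ (P × Q)
  swap (inj₁ p) = inj₂ p
  swap (inj₂ p) = inj₁ p

module ProductWalks {A B K : Graph} (C : Coordinates A B K) where
  open Coordinates C

  alongB : ∀ a {b b'} → Walk B b b' → Walk K (mk a b) (mk a b')
  alongB a = mapʷ (mk a) edge
    where
    edge : ∀ {b b'} → Adj B b b' → Adj K (mk a b) (mk a b')
    edge {b} {b'} e = adj-join (inj₁ (trans (fst-mk a b) (sym (fst-mk a b')) ,
                                      subst₂ (Adj B) (sym (snd-mk a b)) (sym (snd-mk a b')) e))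

  alongA : ∀ b {a a'} → Walk A a a' → Walk K (mk a b) (mk a' b)
  alongA b = mapʷ (λ a → mk a b) edge
    where
    edge : ∀ {a a'} → Adj A a a' → Adj K (mk a b) (mk a' b)
    edge {a} {a'} e = adj-join (inj₂ (trans (snd-mk a b) (sym (snd-mk a' b)) ,
                                      subst₂ (Adj A) (sym (fst-mk a b)) (sym (fst-mk a' b)) e))

  project : ∀ {x y} (w : Walk K x y) →
    Σ (Walk A (fst x) (fst y)) λ α → Σ (Walk B (snd x) (snd y)) λ β → length α + length β ≡ length w
  project (stop x) = stop (fst x) , stop (snd x) , refl
  project (step e w) with adj-split e | project w
  ... | inj₁ (same , e') | α , β , eq =
    retarget (sym same) refl α , step e' β ,
    trans (cong (_+ suc (length β)) (length-retarget (sym same) refl α))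
          (trans (+-suc (length α) (length β)) (cong suc eq))
  ... | inj₂ (same , e') | α , β , eq =
    step e' α , retarget (sym same) refl β ,
    trans (cong (λ l → suc (length α + l)) (length-retarget (sym same) refl β)) (cong suc eq)

  distance-lower-bound : ∀ {x y} (β : Shortest B (snd x) (snd y)) (α : Shortest A (fst x) (fst y)) →
    ∀ (w : Walk K x y) → length (path β) + length (path α) ≤ length w
  distance-lower-bound β α w with project w
  ... | α' , β' , eq = ≤-trans (+-mono-≤ (minimal β β') (minimal α α'))
                               (≤-reflexive (trans (+-comm (length β') (length α')) eq))

  turn : ∀ {x y} c → Walk A (fst x) c → Walk B (snd x) (snd y) → Walk A c (fst y) → Walk K x y
  turn {x} {y} c α₁ β α₂ =
    retarget (mk-fst-snd x) (mk-fst-snd y) (alongA (snd x) α₁ ++ʷ (alongB c β ++ʷ alongA (snd y) α₂))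

  length-turn : ∀ {x y} c (α₁ : Walk A (fst x) c) (β : Walk B (snd x) (snd y)) (α₂ : Walk A c (fst y)) →
    length (turn c α₁ β α₂) ≡ length β + (length α₁ + length α₂)
  length-turn {x} {y} c α₁ β α₂ = begin
    length (turn c α₁ β α₂)
      ≡⟨ length-retarget (mk-fst-snd x) (mk-fst-snd y) _ ⟩
    length (alongA (snd x) α₁ ++ʷ (alongB c β ++ʷ alongA (snd y) α₂))
      ≡⟨ length-++ʷ (alongA (snd x) α₁) _ ⟩
    length (alongA (snd x) α₁) + length (alongB c β ++ʷ alongA (snd y) α₂)
      ≡⟨ cong (length (alongA (snd x) α₁) +_) (length-++ʷ (alongB c β) _) ⟩
    length (alongA (snd x) α₁) + (length (alongB c β) + length (alongA (snd y) α₂))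
      ≡⟨ cong₂ _+_ (length-mapʷ _ _ α₁) (cong₂ _+_ (length-mapʷ _ _ β) (length-mapʷ _ _ α₂)) ⟩
    length α₁ + (length β + length α₂)
      ≡⟨ x∙yz≈y∙xz (length α₁) (length β) (length α₂) ⟩
    length β + (length α₁ + length α₂) ∎
    where open ≡-Reasoning

  ∈ʷ-turn : ∀ {x y} c (α₁ : Walk A (fst x) c) (β : Walk B (snd x) (snd y)) (α₂ : Walk A c (fst y)) →
    ∀ {h} → h ∈ʷ β → mk c h ∈ʷ turn c α₁ β α₂
  ∈ʷ-turn {x} {y} c α₁ β α₂ h∈β =
    ∈ʷ-retarget (mk-fst-snd x) (mk-fst-snd y) _
      (∈ʷ-++ʳ (alongA (snd x) α₁) _ (∈ʷ-++ˡ (alongB c β) _ (∈ʷ-mapʷ _ _ β h∈β)))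

  turn-shortest : (σ : ∀ a a' → Shortest A a a') → ∀ {x y} c → (c ≡ fst x) ⊎ (c ≡ fst y) →
    Shortest B (snd x) (snd y) → Shortest K x y
  turn-shortest σ {x} {y} c c-end β = shortest walk-xy λ w → begin
      length walk-xy                                ≡⟨ length-turn c (path (σ (fst x) c)) (path β) (path (σ c (fst y))) ⟩
      length (path β) + (d (fst x) c + d c (fst y)) ≤⟨ +-mono-≤ (≤-refl {length (path β)})
                                                         (no-detour-at-end σ (fst x) (fst y) c c-end) ⟩
      length (path β) + d (fst x) (fst y)           ≤⟨ distance-lower-bound β (σ (fst x) (fst y)) w ⟩
      length w                                      ∎
    where
    open ≤-Reasoning
    d : ∀ a a' → ℕ
    d a a' = length (path (σ a a'))
    walk-xy : Walk K x y
    walk-xy = turn c (path (σ (fst x) c)) (path β) (path (σ c (fst y)))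

index-zero : ∀ {m} → Fin m → Σ (Fin m) λ z → toℕ z ≡ 0
index-zero {suc m} _ = fzero , refl

index-zero-of-one : ∀ {m} → m ≡ 1 → (i : Fin m) → toℕ i ≡ 0
index-zero-of-one refl fzero = refl

another-element : ∀ {m} → m ≢ 1 → (a : Fin m) → Σ (Fin m) λ a' → a' ≢ a
another-element {suc zero}    m≢1 _        = ⊥-elim (m≢1 refl)
another-element {suc (suc m)} m≢1 fzero    = fsuc fzero , λ ()
another-element {suc (suc m)} m≢1 (fsuc a) = fzero , λ ()

∈-irrelevant : ∀ {m} {p : Subset m} {x} (i j : x ∈ p) → i ≡ j
∈-irrelevant = []=-irrelevant

terminal-of-one-vertex : ∀ {B S} → StrongGeodetic B S → order B ≡ 1 → ∀ b → b ∈ S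
terminal-of-one-vertex (inj₁ (_ , all-in)) B1 b = all-in b
terminal-of-one-vertex (inj₂ (_ , covered)) B1 b with covered b
... | x , y , _ , _ , x<y , _ =
  ⊥-elim (<-irrefl (trans (index-zero-of-one B1 x) (sym (index-zero-of-one B1 y))) x<y)

another-terminal : ∀ {B S} → StrongGeodetic B S → ∀ b → (order B ≡ 1) ⊎ (Σ (Fin (order B)) λ b' → b' ∈ S × b' ≢ b)
another-terminal (inj₁ (B1 , _)) b = inj₁ B1
another-terminal (inj₂ (_ , covered)) b with covered b
... | x , y , xS , yS , x<y , _ with x ≟ᶠ b
...   | yes x≡b = inj₂ (y , yS , λ y≡b → <-irrefl (cong toℕ (trans x≡b (sym y≡b))) x<y)
...   | no  x≢b = inj₂ (x , xS , x≢b)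

module Construction {A B K : Graph} (C : Coordinates A B K) (σ : ∀ a a' → Shortest A a a')
  {S X : Subset (order B)} (S-sg : StrongGeodetic B S) (X⊆S : X ⊆ S) (P : PathChoice B S)
  (X-core : ∀ b → (b ∈ X) ⊎ CoveredBy B S P (λ u w → (u ∈ X) ⊎ (w ∈ X)) b) where
  open Coordinates C
  open ProductWalks C

  Base : Fin (order A) → Set
  Base a = toℕ a ≡ 0

  base-unique : ∀ {a a'} → Base a → Base a' → a ≡ a'
  base-unique a₀ a₀' = toℕ-injective (trans a₀ (sym a₀'))

  row : Fin (order A) → Subset (order B)
  row a with toℕ a ≟ℕ 0
  ... | yes _ = S
  ... | no  _ = X

  row-base : ∀ {a} → Base a → row a ≡ S
  row-base {a} base with toℕ a ≟ℕ 0
  ... | yes _     = refl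
  ... | no ¬base  = ⊥-elim (¬base base)

  row-other : ∀ {a} → ¬ Base a → row a ≡ X
  row-other {a} ¬base with toℕ a ≟ℕ 0
  ... | yes base = ⊥-elim (¬base base)
  ... | no _     = refl

  X⊆row : ∀ a → X ⊆ row a
  X⊆row a {b} with toℕ a ≟ℕ 0
  ... | yes _ = X⊆S
  ... | no  _ = λ b∈X → b∈X

  row⊆S : ∀ a → row a ⊆ S
  row⊆S a with toℕ a ≟ℕ 0
  ... | yes _ = λ b∈S → b∈S
  ... | no  _ = X⊆S

  T : Subset (order K)
  T = tabulate λ v → lookup (row (fst v)) (snd v)

  lookup-T-mk : ∀ a b → lookup T (mk a b) ≡ lookup (row a) b
  lookup-T-mk a b = trans (lookup∘tabulate _ (mk a b)) (cong₂ (λ a b → lookup (row a) b) (fst-mk a b) (snd-mk a b))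

  mk-∈T : ∀ {a b} → b ∈ row a → mk a b ∈ T
  mk-∈T {a} {b} b∈row = lookup⇒[]= (mk a b) T (trans (lookup-T-mk a b) ([]=⇒lookup b∈row))

  ∈T-intro : ∀ {v} → snd v ∈ row (fst v) → v ∈ T
  ∈T-intro {v} v∈row = subst (_∈ T) (mk-fst-snd v) (mk-∈T v∈row)

  T⇒S : ∀ {v} → v ∈ T → snd v ∈ S
  T⇒S {v} v∈T = row⊆S (fst v) (lookup⇒[]= (snd v) (row (fst v)) (trans (sym (lookup∘tabulate _ v)) ([]=⇒lookup v∈T)))

  ∣T∣-bound : ∣ T ∣ ≤ ∣ X ∣ * (order A ∸ 1) + ∣ S ∣
  ∣T∣-bound = begin
    ∣ T ∣                                                     ≡⟨ ∣∣≡∑ T ⟩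
    ∑[ v < order K ] indicator (lookup T v)                   ≡⟨ ∑-pairs _ ⟩
    ∑[ a < order A ] ∑[ b < order B ] indicator (lookup T (mk a b))
      ≡⟨ sum-cong-≗ (λ a → sum-cong-≗ λ b → cong indicator (lookup-T-mk a b)) ⟩
    ∑[ a < order A ] ∑[ b < order B ] indicator (lookup (row a) b) ≡⟨ sum-cong-≗ (λ a → sym (∣∣≡∑ (row a))) ⟩
    ∑[ a < order A ] ∣ row a ∣                                ≤⟨ ∑-first-and-rest _ (λ a base → cong ∣_∣ (row-base base))
                                                                                  (λ a ¬base → cong ∣_∣ (row-other ¬base)) ⟩
    ∣ X ∣ * (order A ∸ 1) + ∣ S ∣                             ∎
    where open ≤-Reasoning

  chosen : ∀ u w → u ∈ S → w ∈ S → Shortest B u w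
  chosen u w uS wS with <-cmp (toℕ u) (toℕ w)
  ... | tri< u<w _ _ = fromGeodesic (P u w uS wS u<w)
  ... | tri≈ _ u≡w _ = subst (Shortest B u) (toℕ-injective u≡w) (stop-shortest u)
  ... | tri> _ _ w<u = reverse-shortest (fromGeodesic (P w u wS uS w<u))

  OnChosen : Fin (order B) → Fin (order B) → Fin (order B) → Set
  OnChosen h u w = ∀ uS wS → h ∈ʷ path (chosen u w uS wS)

  P-irrelevant : ∀ {u w} (uS uS' : u ∈ S) (wS wS' : w ∈ S) (lt lt' : toℕ u < toℕ w) → P u w uS wS lt ≡ P u w uS' wS' lt'
  P-irrelevant uS uS' wS wS' lt lt'
    rewrite ∈-irrelevant uS uS' | ∈-irrelevant wS wS' | <-irrelevant lt lt' = refl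

  on-chosen : ∀ {h u w uS wS lt} → h OnGeod P u w uS wS lt → OnChosen h u w × OnChosen h w u
  on-chosen {h} {u} {w} {uS} {wS} {lt} on = forward , backward
    where
    on-P : ∀ uS' wS' lt' → h ∈ʷ path (fromGeodesic (P u w uS' wS' lt'))
    on-P uS' wS' lt' = fromGeodesic-∈ʷ (P u w uS' wS' lt') (subst (h OnGeod_) (P-irrelevant uS uS' wS wS' lt lt') on)

    forward : OnChosen h u w
    forward uS' wS' with <-cmp (toℕ u) (toℕ w)
    ... | tri< u<w _ _ = on-P uS' wS' u<w
    ... | tri≈ ¬u<w _ _ = ⊥-elim (¬u<w lt)
    ... | tri> ¬u<w _ _ = ⊥-elim (¬u<w lt)

    backward : OnChosen h w u
    backward wS' uS' with <-cmp (toℕ w) (toℕ u)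
    ... | tri< w<u _ _ = ⊥-elim (<-asym lt w<u)
    ... | tri≈ _ w≡u _ = ⊥-elim (<-irrefl (sym w≡u) lt)
    ... | tri> _ _ u<w = ∈ʷ-reverse _ (on-P uS' wS' u<w)

  crossing : Fin (order A) → Fin (order A) → Fin (order A)
  crossing a a' with toℕ a' ≟ℕ 0
  ... | yes _ = a
  ... | no  _ = a'

  crossing-at-end : ∀ a a' → (crossing a a' ≡ a) ⊎ (crossing a a' ≡ a')
  crossing-at-end a a' with toℕ a' ≟ℕ 0
  ... | yes _ = inj₁ refl
  ... | no  _ = inj₂ refl

  crossing-into-base : ∀ {a a'} → Base a' → crossing a a' ≡ a
  crossing-into-base {a} {a'} base' with toℕ a' ≟ℕ 0
  ... | yes _      = refl
  ... | no ¬base'  = ⊥-elim (¬base' base')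

  crossing-from-base : ∀ {a a'} → Base a → crossing a a' ≡ a'
  crossing-from-base {a} {a'} base with toℕ a' ≟ℕ 0
  ... | yes base' = base-unique base base'
  ... | no _      = refl

  route : ∀ x y → snd x ∈ S → snd y ∈ S → Shortest K x y
  route x y xS yS =
    turn-shortest σ (crossing (fst x) (fst y)) (crossing-at-end (fst x) (fst y)) (chosen (snd x) (snd y) xS yS)

  ∈-route : ∀ {v} x y xS yS → crossing (fst x) (fst y) ≡ fst v → OnChosen (snd v) (snd x) (snd y) →
    v ∈ʷ path (route x y xS yS)
  ∈-route {v} x y xS yS same-layer on =
    ∈ʷ-resp-≡ (path (route x y xS yS)) (trans (cong (λ a → mk a (snd v)) same-layer) (mk-fst-snd v))
      (∈ʷ-turn {x} {y} c (path (σ (fst x) c)) (path (chosen (snd x) (snd y) xS yS)) (path (σ c (fst y))) (on xS yS))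
    where
    c : Fin (order A)
    c = crossing (fst x) (fst y)

  T-paths : PathChoice K T
  T-paths x y xT yT _ = toGeodesic (route x y (T⇒S xT) (T⇒S yT))

  Covered : Fin (order K) → Set
  Covered = CoveredBy K T T-paths (λ _ _ → ⊤)

  covered-between : ∀ {v} p t (pT : p ∈ T) (tT : t ∈ T) → p ≢ t →
    v ∈ʷ path (route p t (T⇒S pT) (T⇒S tT)) → v ∈ʷ path (route t p (T⇒S tT) (T⇒S pT)) → Covered v
  covered-between p t pT tT p≢t on-pt on-tp with <-cmp (toℕ p) (toℕ t)
  ... | tri< p<t _ _ = p , t , pT , tT , p<t , tt , toGeodesic-∈ʷ (route p t (T⇒S pT) (T⇒S tT)) on-pt
  ... | tri≈ _ p≡t _ = ⊥-elim (p≢t (toℕ-injective p≡t))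
  ... | tri> _ _ t<p = t , p , tT , pT , t<p , tt , toGeodesic-∈ʷ (route t p (T⇒S tT) (T⇒S pT)) on-tp

  covered-end : ∀ {v t} → v ∈ T → t ∈ T → t ≢ v → Covered v
  covered-end {v} {t} vT tT t≢v =
    covered-between v t vT tT (λ v≡t → t≢v (sym v≡t)) (start∈ʷ _) (end∈ʷ _)

  partner : order K ≢ 1 → ∀ {v} → snd v ∈ X → Σ (Fin (order K)) λ t → t ∈ T × t ≢ v
  partner K≢1 {v} vX with another-terminal S-sg (snd v)
  ... | inj₁ B1 =
    let a' , a'≢ = another-element A≢1 (fst v) in
    mk a' (snd v) , mk-∈T (X⊆row a' vX) , λ t≡v → a'≢ (trans (sym (fst-mk a' (snd v))) (cong fst t≡v))
    where
    A≢1 : order A ≢ 1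
    A≢1 A1 = K≢1 (trans order-K (cong₂ _*_ A1 B1))
  ... | inj₂ (b' , b'S , b'≢) =
    let a₀ , base = index-zero (fst v) in
    mk a₀ b' , mk-∈T (subst (b' ∈_) (sym (row-base base)) b'S) ,
    λ t≡v → b'≢ (trans (sym (snd-mk a₀ b')) (cong snd t≡v))

  covered-interior : ∀ v {c d} → c ∈ X → d ∈ S → c ≢ d →
    OnChosen (snd v) c d → OnChosen (snd v) d c → Covered v
  covered-interior v {c} {d} cX dS c≢d on-cd on-dc =
    covered-between p t pT tT p≢t
      (∈-route p t _ _ (trans (crossing-into-base t-base) (fst-mk (fst v) c))
        (subst₂ (OnChosen (snd v)) (sym (snd-mk (fst v) c)) (sym (snd-mk a₀ d)) on-cd))
      (∈-route t p _ _ (trans (crossing-from-base t-base) (fst-mk (fst v) c))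
        (subst₂ (OnChosen (snd v)) (sym (snd-mk a₀ d)) (sym (snd-mk (fst v) c)) on-dc))
    where
    a₀ : Fin (order A)
    a₀ = proj₁ (index-zero (fst v))
    p t : Fin (order K)
    p = mk (fst v) c
    t = mk a₀ d
    t-base : Base (fst t)
    t-base = trans (cong toℕ (fst-mk a₀ d)) (proj₂ (index-zero (fst v)))
    pT : p ∈ T
    pT = mk-∈T (X⊆row (fst v) cX)
    tT : t ∈ T
    tT = mk-∈T (subst (d ∈_) (sym (row-base (proj₂ (index-zero (fst v))))) dS)
    p≢t : p ≢ t
    p≢t p≡t = c≢d (trans (sym (snd-mk (fst v) c)) (trans (cong snd p≡t) (snd-mk a₀ d)))

  all-covered : order K ≢ 1 → ∀ v → Covered v
  all-covered K≢1 v with X-core (snd v)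
  ... | inj₁ vX = let t , tT , t≢v = partner K≢1 vX in covered-end (∈T-intro (X⊆row (fst v) vX)) tT t≢v
  ... | inj₂ (u , w , uS , wS , u<w , inj₁ uX , on) =
    covered-interior v uX wS (λ u≡w → <-irrefl (cong toℕ u≡w) u<w) (proj₁ (on-chosen on)) (proj₂ (on-chosen on))
  ... | inj₂ (u , w , uS , wS , u<w , inj₂ wX , on) =
    covered-interior v wX uS (λ w≡u → <-irrefl (cong toℕ (sym w≡u)) u<w) (proj₂ (on-chosen on)) (proj₁ (on-chosen on))

  all-in-T : order K ≡ 1 → ∀ v → v ∈ T
  all-in-T K1 v =
    ∈T-intro (subst (snd v ∈_) (sym (row-base (index-zero-of-one A1 (fst v)))) (terminal-of-one-vertex S-sg B1 (snd v)))
    where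
    A1 : order A ≡ 1
    A1 = m*n≡1⇒m≡1 (order A) (order B) (trans (sym order-K) K1)
    B1 : order B ≡ 1
    B1 = m*n≡1⇒n≡1 (order A) (order B) (trans (sym order-K) K1)

  T-strong-geodetic : StrongGeodetic K T
  T-strong-geodetic with order K ≟ℕ 1
  ... | yes K1 = inj₁ (K1 , all-in-T K1)
  ... | no K≢1 = inj₂ (T-paths , all-covered K≢1)

product-bound-¬¬ : ∀ {A B K} → Coordinates A B K → Connected A → ∀ {sgB sgcB sgK} →
  HasSg B sgB → HasSgc B sgcB → HasSg K sgK → ¬ ¬ (sgK ≤ sgcB * (order A ∸ 1) + sgB)
product-bound-¬¬ {A} C A-connected (S' , S'-sg , refl) ((S , X , S-sg , (X⊆S , P , X-core) , refl) , _) (U , U-sg , refl) =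
  ¬¬-map bound (shortest-walks-¬¬ A A-connected)
  where
  -- U is minimum, and the sg-set S carrying the core X is no larger than S'.
  bound : (∀ a a' → Shortest A a a') → ∣ U ∣ ≤ ∣ X ∣ * (order A ∸ 1) + ∣ S' ∣
  bound σ = begin
    ∣ U ∣                          ≤⟨ proj₂ U-sg T T-strong-geodetic ⟩
    ∣ T ∣                          ≤⟨ ∣T∣-bound ⟩
    ∣ X ∣ * (order A ∸ 1) + ∣ S ∣  ≤⟨ +-monoʳ-≤ (∣ X ∣ * (order A ∸ 1)) (proj₂ S-sg S' (proj₁ S'-sg)) ⟩
    ∣ X ∣ * (order A ∸ 1) + ∣ S' ∣ ∎
    where
    open Construction C σ (proj₁ S-sg) X⊆S P X-core
    open ≤-Reasoning

theorem5p1 : (G H : Graph) → Connected G → Connected H →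
    (sgG sgcG sgH sgcH sgGH : ℕ) →
    HasSg G sgG → HasSgc G sgcG → HasSg H sgH → HasSgc H sgcH →
    HasSg (G □ H) sgGH →
    sgGH ≤ ((sgcH * (n G ∸ 1) + sgH) ⊓ (sgcG * (n H ∸ 1) + sgG))
theorem5p1 G H G-connected H-connected sgG sgcG sgH sgcH sgGH G-sg G-sgc H-sg H-sgc GH-sg =
  ⊓-glb (decidable-stable (_ ≤? _) (product-bound-¬¬ (□-coordinates G H) G-connected H-sg H-sgc GH-sg))
        (decidable-stable (_ ≤? _) (product-bound-¬¬ (□-coordinates-swapped G H) H-connected G-sg G-sgc GH-sg))
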